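{- Let $G$ be a multigraph with $n$ vertices, $m$ edges and maximum degree $\Delta(G)$, and let $k$ be an integer with $m \ge k$. There is an algorithm that returns a subgraph $G' \subseteq G$ with $n$ vertices and exactly $k$ edges such that $\Delta(G') \le \frac{(2k+4n)\Delta(G)}{m}$.
   Context: Graphs are undirected, unweighted multigraphs (multiple edges and self-loops allowed; a self-loop adds $2$ to the degree of its vertex). $\Delta(\cdot)$ denotes maximum degree. -}

module Defs where

open import Data.Nat using (ℕ; zero; suc; _+_; _⊔_)
open import Data.Fin using (Fin; _≟_)
open import Data.Product using (_×_; _,_)
open import Data.List using (List; []; _∷_; foldr; map; allFin)
open import Data.Nat.ListAction using (sum)
open import Relation.Nullary.Decidable using (does)
open import Data.Bool using (if_then_else_)

-- A multigraph on vertex set Fin n: a list of edges (each edge an unordered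
-- pair of endpoints, stored as an ordered pair; self-loops and repeated edges
-- allowed).  Edges are distinct objects, identified by their list position.
record Multigraph (n : ℕ) : Set where
  constructor mkGraph
  field
    edges : List (Fin n × Fin n)
open Multigraph public

numEdges : ∀ {n} → Multigraph n → ℕ
numEdges G = Data.List.length (edges G)

-- number of endpoints of edge e equal to v (a self-loop at v counts 2)
incid : ∀ {n} → Fin n → Fin n × Fin n → ℕ
incid v (a , b) = (if does (v ≟ a) then 1 else 0) + (if does (v ≟ b) then 1 else 0)

deg : ∀ {n} → Multigraph n → Fin n → ℕ
deg G v = sum (map (incid v) (edges G))

-- maximum degree Δ(G) (0 for the empty vertex set)
maxDeg : ∀ {n} → Multigraph n → ℕ
maxDeg {n} G = foldr (λ v acc → deg G v ⊔ acc) 0 (allFin n)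

-- spanning subgraph: same vertex set, edge multiset a sub-collection of G's
-- edges (a subsequence of the edge list, i.e. a choice of a subset of edges)
_⊑_ : ∀ {n} → Multigraph n → Multigraph n → Set
H ⊑ G = Data.List.Relation.Binary.Sublist.Propositional._⊆_ (edges H) (edges G)
  where import Data.List.Relation.Binary.Sublist.Propositional

-- Split the edges into two classes whose degrees differ by at most 2 at every vertex:
-- orient the bipartite double cover (edge ab becomes a₁b₂) so that in- and out-degree
-- differ by at most 1 everywhere, and colour each edge by the direction of its copy; at v
-- the two classes then have degrees out(v₁) + in(v₂) and in(v₁) + out(v₂). Such a
-- balanced orientation exists because two edges ab, ac with a ≠ b can be replaced by the
-- single edge bc and, once bc is oriented, split back into a directed path through a.
-- The larger class keeps at least half of the m edges and at least halves the excess
-- Δ − 2, so halving until at most 2k edges remain and then keeping any k of them gives H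
-- with (Δ(H) − 2)·m ≤ 2k·(Δ(G) − 2). As m ≤ n·Δ(G), Δ(H)·m ≤ 2m + 2kΔ(G) ≤ (2k + 4n)Δ(G).
module Submission where

open import Defs
open import Algebra.Properties.CommutativeSemigroup as CommSemigroupProperties using ()
open import Data.Bool using (if_then_else_)
open import Data.Empty using (⊥-elim)
open import Data.Fin using () renaming (_≟_ to _≟ᶠ_)
open import Data.List using (List; []; _∷_; _++_; length; map; foldr; take; allFin)
open import Data.List.Membership.Propositional using (_∈_)
open import Data.List.Membership.Propositional.Properties using (∈-allFin)
open import Data.List.Properties using (map-++; length-take; length-tabulate)
open import Data.List.Relation.Binary.Permutation.Propositional.Properties
  using (shift; ↭-length) renaming (map⁺ to ↭-map⁺)
open import Data.List.Relation.Binary.Pointwise using (Pointwise; []; _∷_; ++⁺)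
open import Data.List.Relation.Binary.Sublist.Propositional using (_⊆_; []; _∷_; _∷ʳ_; ⊆-trans)
open import Data.List.Relation.Binary.Sublist.Propositional.Properties using (take-⊆)
open import Data.List.Relation.Ternary.Interleaving.Properties using (interleave-length)
open import Data.List.Relation.Ternary.Interleaving.Propositional
  using (Interleaving; []; consˡ; consʳ; swap; toPermutation)
open import Data.List.Relation.Unary.Any using (here; there)
open import Data.Nat using (ℕ; suc; _+_; _*_; _∸_; _⊔_; _≤_; _<_; z≤n; s≤s; _≤?_)
open import Data.Nat.Induction using (<-wellFounded)
open import Data.Nat.ListAction using (sum)
open import Data.Nat.ListAction.Properties using (sum-++; sum-↭)
open import Data.Nat.Properties
open import Data.Product using (Σ; ∃-syntax; _×_; _,_; proj₁; proj₂)
import Data.Product as Product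
open import Data.Sum using (_⊎_; inj₁; inj₂)
open import Data.Sum.Properties using (≡-dec)
open import Function using (_∘_; id)
open import Induction.WellFounded using (Acc; acc)
open import Relation.Binary.Definitions using (DecidableEquality)
open import Relation.Binary.PropositionalEquality
open import Relation.Nullary using (¬_; yes; no; does)

open CommSemigroupProperties +-commutativeSemigroup using ()
  renaming (interchange to [m+n]+[o+p]≡[m+o]+[n+p]; x∙yz≈y∙xz to m+[n+o]≡n+[m+o])
open CommSemigroupProperties *-commutativeSemigroup using ()
  renaming (x∙yz≈y∙xz to m*[n*o]≡n*[m*o])

module _ {A : Set} (f : A → ℕ) where

  sum-map-insert : ∀ xs x ys → sum (map f (xs ++ x ∷ ys)) ≡ f x + sum (map f (xs ++ ys))
  sum-map-insert xs x ys = sum-↭ (↭-map⁺ f (shift x xs ys))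

  sum-map-interleaving : ∀ {xs ys zs} → Interleaving xs ys zs →
                         sum (map f zs) ≡ sum (map f xs) + sum (map f ys)
  sum-map-interleaving {xs} {ys} {zs} xs⋈ys = begin
    sum (map f zs)                  ≡⟨ sum-↭ (↭-map⁺ f (toPermutation xs⋈ys)) ⟩
    sum (map f (xs ++ ys))          ≡⟨ cong sum (map-++ f xs ys) ⟩
    sum (map f xs ++ map f ys)      ≡⟨ sum-++ (map f xs) (map f ys) ⟩
    sum (map f xs) + sum (map f ys) ∎
    where open ≡-Reasoning

  sum-map-mono-⊆ : ∀ {xs ys} → xs ⊆ ys → sum (map f xs) ≤ sum (map f ys)
  sum-map-mono-⊆ []           = z≤n
  sum-map-mono-⊆ (y ∷ʳ xs⊆ys) = ≤-trans (sum-map-mono-⊆ xs⊆ys) (m≤n+m _ (f y))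
  sum-map-mono-⊆ (refl ∷ xs⊆ys) = +-monoʳ-≤ _ (sum-map-mono-⊆ xs⊆ys)

  ∈⇒≤sum-map : ∀ {x xs} → x ∈ xs → f x ≤ sum (map f xs)
  ∈⇒≤sum-map (here refl) = m≤m+n _ _
  ∈⇒≤sum-map (there x∈xs) = ≤-trans (∈⇒≤sum-map x∈xs) (m≤n+m _ _)

  sum-map-≤ : ∀ {B} → (∀ x → f x ≤ B) → ∀ xs → sum (map f xs) ≤ length xs * B
  sum-map-≤ f≤B []       = z≤n
  sum-map-≤ f≤B (x ∷ xs) = +-mono-≤ (f≤B x) (sum-map-≤ f≤B xs)

  foldr-⊔-upper : ∀ {x xs} → x ∈ xs → f x ≤ foldr (λ y acc → f y ⊔ acc) 0 xs
  foldr-⊔-upper (here refl) = m≤m⊔n _ _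
  foldr-⊔-upper {xs = y ∷ _} (there x∈xs) = ≤-trans (foldr-⊔-upper x∈xs) (m≤n⊔m (f y) _)

  *-foldr-⊔-lub : ∀ c {B} → (∀ x → c * f x ≤ B) → ∀ xs → c * foldr (λ y acc → f y ⊔ acc) 0 xs ≤ B
  *-foldr-⊔-lub c c*f≤B []       = ≤-trans (≤-reflexive (*-zeroʳ c)) z≤n
  *-foldr-⊔-lub c c*f≤B (x ∷ xs) =
    ≤-trans (≤-reflexive (*-distribˡ-⊔ c (f x) _)) (⊔-lub (c*f≤B x) (*-foldr-⊔-lub c c*f≤B xs))

sum-map-+ : ∀ {A : Set} (f g : A → ℕ) xs →
            sum (map (λ x → f x + g x) xs) ≡ sum (map f xs) + sum (map g xs)
sum-map-+ f g []       = refl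
sum-map-+ f g (x ∷ xs) =
  trans (cong (f x + g x +_) (sum-map-+ f g xs)) ([m+n]+[o+p]≡[m+o]+[n+p] (f x) (g x) _ _)

interleaving⇒⊆ˡ : ∀ {A : Set} {xs ys zs : List A} → Interleaving xs ys zs → xs ⊆ zs
interleaving⇒⊆ˡ []          = []
interleaving⇒⊆ˡ (consˡ xs⋈ys) = refl ∷ interleaving⇒⊆ˡ xs⋈ys
interleaving⇒⊆ˡ (consʳ xs⋈ys) = _ ∷ʳ interleaving⇒⊆ˡ xs⋈ys

interleaving-major : ∀ {A : Set} {xs ys zs : List A} {y} → Interleaving xs (y ∷ ys) zs →
                     length (y ∷ ys) ≤ length xs → length xs < length zs × length zs ≤ 2 * length xs
interleaving-major {xs = xs} {ys} {zs} xs⋈ys |ys|<|xs| =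
  subst (length xs <_) (sym |zs|≡) (m<m+n (length xs) (s≤s z≤n)) , (begin
    length zs                  ≡⟨ |zs|≡ ⟩
    length xs + suc (length ys) ≤⟨ +-monoʳ-≤ (length xs) |ys|<|xs| ⟩
    length xs + length xs      ≡⟨ cong (length xs +_) (+-identityʳ (length xs)) ⟨
    2 * length xs              ∎)
  where
  open ≤-Reasoning
  |zs|≡ : length zs ≡ length xs + suc (length ys)
  |zs|≡ = interleave-length xs⋈ys

module _ {A B : Set} {R : A → B → Set} where

  pointwise-++⁻ : ∀ xs {ys zs} → Pointwise R (xs ++ ys) zs →
                  ∃[ zs₁ ] ∃[ zs₂ ] zs ≡ zs₁ ++ zs₂ × Pointwise R xs zs₁ × Pointwise R ys zs₂
  pointwise-++⁻ []       rs       = [] , _ , refl , [] , rs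
  pointwise-++⁻ (x ∷ xs) (r ∷ rs) with pointwise-++⁻ xs rs
  ... | zs₁ , zs₂ , refl , rs₁ , rs₂ = _ ∷ zs₁ , zs₂ , refl , r ∷ rs₁ , rs₂

module BalancedOrientation {V : Set} (_≟_ : DecidableEquality V) where

  Edge : Set
  Edge = V × V

  δ : V → V → ℕ
  δ x y = if does (x ≟ y) then 1 else 0

  δ-refl : ∀ x → δ x x ≡ 1
  δ-refl x with x ≟ x
  ... | yes _  = refl
  ... | no x≢x = ⊥-elim (x≢x refl)

  δ≤1 : ∀ x y → δ x y ≤ 1
  δ≤1 x y with x ≟ y
  ... | yes _ = ≤-refl
  ... | no _  = z≤n

  incidence : V → Edge → ℕ
  incidence x (a , b) = δ x a + δ x b

  outdeg indeg degree : V → List Edge → ℕ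
  outdeg x = sum ∘ map (δ x ∘ proj₁)
  indeg  x = sum ∘ map (δ x ∘ proj₂)
  degree x = sum ∘ map (incidence x)

  degree-interleaving : ∀ {C C′ E} → Interleaving C C′ E → ∀ v →
                        degree v E ≡ degree v C + degree v C′
  degree-interleaving C⋈C′ v = sum-map-interleaving (incidence v) C⋈C′

  Balanced : List Edge → Set
  Balanced O = ∀ x → outdeg x O ≤ suc (indeg x O) × indeg x O ≤ suc (outdeg x O)

  infix 4 _⇄_
  data _⇄_ : Edge → Edge → Set where
    keep : ∀ {a b} → (a , b) ⇄ (a , b)
    flip : ∀ {a b} → (a , b) ⇄ (b , a)

  ⇄-flipʳ : ∀ {e a c} → e ⇄ (a , c) → e ⇄ (c , a)
  ⇄-flipʳ keep = flip
  ⇄-flipʳ flip = keep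

  Orientation : List Edge → List Edge → Set
  Orientation = Pointwise _⇄_

  degree≡outdeg+indeg : ∀ {E O} → Orientation E O → ∀ x → degree x E ≡ outdeg x O + indeg x O
  degree≡outdeg+indeg [] x = refl
  degree≡outdeg+indeg {(a , b) ∷ E} (keep ∷ p) x =
    trans (cong (δ x a + δ x b +_) (degree≡outdeg+indeg p x))
          ([m+n]+[o+p]≡[m+o]+[n+p] (δ x a) (δ x b) _ _)
  degree≡outdeg+indeg {(a , b) ∷ E} (flip ∷ p) x =
    trans (cong₂ _+_ (+-comm (δ x a) (δ x b)) (degree≡outdeg+indeg p x))
          ([m+n]+[o+p]≡[m+o]+[n+p] (δ x b) (δ x a) _ _)

  balanced-shift : ∀ O O′ (t : V → ℕ) →
                   (∀ x → outdeg x O′ ≡ t x + outdeg x O) → (∀ x → indeg x O′ ≡ t x + indeg x O) →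
                   Balanced O → Balanced O′
  balanced-shift O O′ t out in′ bal x rewrite out x | in′ x =
    shifted (proj₁ (bal x)) , shifted (proj₂ (bal x))
    where
    shifted : ∀ {p q} → p ≤ suc q → t x + p ≤ suc (t x + q)
    shifted {p} {q} p≤1+q = ≤-trans (+-monoʳ-≤ (t x) p≤1+q) (≤-reflexive (+-suc (t x) q))

  balanced-∷-loop : ∀ {O} a → Balanced O → Balanced ((a , a) ∷ O)
  balanced-∷-loop {O} a = balanced-shift O ((a , a) ∷ O) (λ x → δ x a) (λ _ → refl) (λ _ → refl)

  balanced-∷-isolated : ∀ {O a} b → ¬ a ≡ b → outdeg a O ≡ 0 → indeg a O ≡ 0 → Balanced O →
                        ∃[ o ] (a , b) ⇄ o × Balanced (o ∷ O)
  balanced-∷-isolated {O} {a} b a≢b out≡0 in≡0 bal with outdeg b O ≤? indeg b O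
  ... | yes out≤in = (b , a) , flip , bal′
    where
    bal′ : Balanced ((b , a) ∷ O)
    bal′ x with x ≟ a
    ... | yes refl rewrite out≡0 | in≡0 = +-monoˡ-≤ 0 (≤-trans (δ≤1 a b) (s≤s z≤n)) , s≤s z≤n
    ... | no _ with x ≟ b
    ...   | yes refl = s≤s out≤in , m≤n⇒m≤1+n (proj₂ (bal x))
    ...   | no _ = bal x
  ... | no out≰in = (a , b) , keep , bal′
    where
    bal′ : Balanced ((a , b) ∷ O)
    bal′ x with x ≟ a
    ... | yes refl rewrite out≡0 | in≡0 = s≤s z≤n , +-monoˡ-≤ 0 (≤-trans (δ≤1 a b) (s≤s z≤n))
    ... | no _ with x ≟ b
    ...   | yes refl = m≤n⇒m≤1+n (proj₁ (bal x)) , s≤s (≰⇒≥ out≰in)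
    ...   | no _ = bal x

  balanced-splice : ∀ {a b c e} P Q {O} → e ⇄ (a , c) →
                    Orientation ((b , c) ∷ P ++ Q) O → Balanced O →
                    ∃[ O′ ] Orientation ((a , b) ∷ P ++ e ∷ Q) O′ × Balanced O′
  balanced-splice {a} {b} {c} P Q e⇄ac (keep ∷ p) bal with pointwise-++⁻ P p
  ... | Oᴾ , Oᵠ , refl , pᴾ , pᵠ =
    (b , a) ∷ Oᴾ ++ (a , c) ∷ Oᵠ , flip ∷ ++⁺ pᴾ (e⇄ac ∷ pᵠ) ,
    balanced-shift ((b , c) ∷ Oᴾ ++ Oᵠ) ((b , a) ∷ Oᴾ ++ (a , c) ∷ Oᵠ) (λ x → δ x a)
      (λ x → trans (cong (δ x b +_) (sum-map-insert (δ x ∘ proj₁) Oᴾ (a , c) Oᵠ))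
                   (m+[n+o]≡n+[m+o] (δ x b) (δ x a) _))
      (λ x → cong (δ x a +_) (sum-map-insert (δ x ∘ proj₂) Oᴾ (a , c) Oᵠ))
      bal
  balanced-splice {a} {b} {c} P Q e⇄ac (flip ∷ p) bal with pointwise-++⁻ P p
  ... | Oᴾ , Oᵠ , refl , pᴾ , pᵠ =
    (a , b) ∷ Oᴾ ++ (c , a) ∷ Oᵠ , keep ∷ ++⁺ pᴾ (⇄-flipʳ e⇄ac ∷ pᵠ) ,
    balanced-shift ((c , b) ∷ Oᴾ ++ Oᵠ) ((a , b) ∷ Oᴾ ++ (c , a) ∷ Oᵠ) (λ x → δ x a)
      (λ x → cong (δ x a +_) (sum-map-insert (δ x ∘ proj₁) Oᴾ (c , a) Oᵠ))
      (λ x → trans (cong (δ x b +_) (sum-map-insert (δ x ∘ proj₂) Oᴾ (c , a) Oᵠ))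
                   (m+[n+o]≡n+[m+o] (δ x b) (δ x a) _))
      bal

  EdgeAt : V → List Edge → Set
  EdgeAt a E = ∃[ P ] ∃[ e ] ∃[ Q ] ∃[ c ] E ≡ P ++ e ∷ Q × e ⇄ (a , c)

  edge-at? : ∀ a E → EdgeAt a E ⊎ degree a E ≡ 0
  edge-at? a [] = inj₂ refl
  edge-at? a ((p , q) ∷ E) with a ≟ p
  ... | yes refl = inj₁ ([] , _ , E , q , refl , keep)
  ... | no _ with a ≟ q
  ...   | yes refl = inj₁ ([] , _ , E , p , refl , flip)
  ...   | no _ with edge-at? a E
  ...     | inj₁ (P , e , Q , c , refl , e⇄ac) = inj₁ ((p , q) ∷ P , e , Q , c , refl , e⇄ac)
  ...     | inj₂ degree≡0 = inj₂ degree≡0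

  balanced-orientation : ∀ E → ∃[ O ] Orientation E O × Balanced O
  balanced-orientation E = go E (<-wellFounded (length E))
    where
    go : ∀ E → Acc _<_ (length E) → ∃[ O ] Orientation E O × Balanced O
    go [] _ = [] , [] , λ _ → z≤n , z≤n
    go ((a , b) ∷ E) (acc rec) with a ≟ b | edge-at? a E
    ... | yes refl | _ =
      let O , p , bal = go E (rec ≤-refl) in (a , a) ∷ O , keep ∷ p , balanced-∷-loop {O} a bal
    ... | no a≢b | inj₁ (P , e , Q , c , refl , e⇄ac) =
      let O , p , bal = go ((b , c) ∷ P ++ Q) (rec (s≤s (≤-reflexive (sym (↭-length (shift e P Q))))))
      in balanced-splice P Q e⇄ac p bal
    ... | no a≢b | inj₂ degree≡0 =
      let O , p , bal = go E (rec ≤-refl)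
          deg≡out+in = trans (sym (degree≡outdeg+indeg p a)) degree≡0
          o , ab⇄o , bal′ = balanced-∷-isolated {O} b a≢b
                              (m+n≡0⇒m≡0 _ deg≡out+in) (m+n≡0⇒n≡0 (outdeg a O) deg≡out+in) bal
      in o ∷ O , ab⇄o ∷ p , bal′

module EquitableSplit {V : Set} (_≟_ : DecidableEquality V) where

  open BalancedOrientation _≟_ using (Edge; δ; degree; degree-interleaving)
  private module Cover = BalancedOrientation (≡-dec _≟_ _≟_)
  open Cover using (keep; flip)

  cover : List Edge → List Cover.Edge
  cover = map (Product.map inj₁ inj₂)

  kept flipped : ∀ E {O} → Cover.Orientation (cover E) O → List Edge
  kept [] [] = []
  kept (e ∷ E) (keep ∷ p) = e ∷ kept E p
  kept (e ∷ E) (flip ∷ p) = kept E p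
  flipped [] [] = []
  flipped (e ∷ E) (keep ∷ p) = flipped E p
  flipped (e ∷ E) (flip ∷ p) = e ∷ flipped E p

  kept-flipped-interleaving : ∀ E {O} (p : Cover.Orientation (cover E) O) →
                              Interleaving (kept E p) (flipped E p) E
  kept-flipped-interleaving [] [] = []
  kept-flipped-interleaving (e ∷ E) (keep ∷ p) = consˡ (kept-flipped-interleaving E p)
  kept-flipped-interleaving (e ∷ E) (flip ∷ p) = consʳ (kept-flipped-interleaving E p)

  degree-kept : ∀ E {O} (p : Cover.Orientation (cover E) O) v →
                degree v (kept E p) ≡ Cover.outdeg (inj₁ v) O + Cover.indeg (inj₂ v) O
  degree-kept [] [] v = refl
  degree-kept ((a , b) ∷ E) (keep ∷ p) v =
    trans (cong (δ v a + δ v b +_) (degree-kept E p v)) ([m+n]+[o+p]≡[m+o]+[n+p] (δ v a) _ _ _)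
  degree-kept (e ∷ E) (flip ∷ p) v = degree-kept E p v

  degree-flipped : ∀ E {O} (p : Cover.Orientation (cover E) O) v →
                   degree v (flipped E p) ≡ Cover.indeg (inj₁ v) O + Cover.outdeg (inj₂ v) O
  degree-flipped [] [] v = refl
  degree-flipped (e ∷ E) (keep ∷ p) v = degree-flipped E p v
  degree-flipped ((a , b) ∷ E) (flip ∷ p) v =
    trans (cong (δ v a + δ v b +_) (degree-flipped E p v)) ([m+n]+[o+p]≡[m+o]+[n+p] (δ v a) _ _ _)

  equitable-split : ∀ E → ∃[ R ] ∃[ B ] Interleaving R B E ×
                    (∀ v → degree v R ≤ 2 + degree v B) × (∀ v → degree v B ≤ 2 + degree v R)
  equitable-split E with Cover.balanced-orientation (cover E)
  ... | O , p , bal =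
    kept E p , flipped E p , kept-flipped-interleaving E p ,
    (λ v → subst₂ _≤_ (sym (degree-kept E p v)) (cong (2 +_) (sym (degree-flipped E p v)))
             (+-suc-mono-≤ (proj₁ (bal (inj₁ v))) (proj₂ (bal (inj₂ v))))) ,
    (λ v → subst₂ _≤_ (sym (degree-flipped E p v)) (cong (2 +_) (sym (degree-kept E p v)))
             (+-suc-mono-≤ (proj₂ (bal (inj₁ v))) (proj₁ (bal (inj₂ v)))))
    where
    +-suc-mono-≤ : ∀ {m n p q} → m ≤ suc n → p ≤ suc q → m + p ≤ 2 + (n + q)
    +-suc-mono-≤ {n = n} {q = q} m≤ p≤ = ≤-trans (+-mono-≤ m≤ p≤) (≤-reflexive (cong suc (+-suc n q)))

  major-part : ∀ E → ∃[ C ] ∃[ C′ ] Interleaving C C′ E × length C′ ≤ length C ×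
               (∀ v → degree v C ≤ 2 + degree v C′)
  major-part E with equitable-split E
  ... | R , B , R⋈B , R≤2+B , B≤2+R with length B ≤? length R
  ...   | yes |B|≤|R| = R , B , R⋈B , |B|≤|R| , R≤2+B
  ...   | no  |B|≰|R| = B , R , swap R⋈B , ≰⇒≥ |B|≰|R| , B≤2+R

  double-degree-≤ : ∀ {C C′ E} → Interleaving C C′ E → ∀ {v} →
                    degree v C ≤ 2 + degree v C′ → 2 * degree v C ≤ 2 + degree v E
  double-degree-≤ {C} {C′} {E} C⋈C′ {v} C≤2+C′ = begin
    2 * degree v C                    ≡⟨ cong (degree v C +_) (+-identityʳ (degree v C)) ⟩
    degree v C + degree v C           ≤⟨ +-monoʳ-≤ (degree v C) C≤2+C′ ⟩
    degree v C + (2 + degree v C′)    ≡⟨ m+[n+o]≡n+[m+o] (degree v C) 2 (degree v C′) ⟩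
    2 + (degree v C + degree v C′)    ≡⟨ cong (2 +_) (degree-interleaving C⋈C′ v) ⟨
    2 + degree v E                    ∎
    where open ≤-Reasoning

module _ {n : ℕ} where

  -- For V = Fin n, degree v (edges G) unfolds to deg G v, so the lemmas on degree apply to deg.
  open BalancedOrientation (_≟ᶠ_ {n}) using (δ; δ-refl; degree-interleaving)

  deg≤maxDeg : ∀ (G : Multigraph n) v → deg G v ≤ maxDeg G
  deg≤maxDeg G v = foldr-⊔-upper (deg G) (∈-allFin v)

  *-maxDeg-lub : ∀ (G : Multigraph n) c {B} → (∀ v → c * deg G v ≤ B) → c * maxDeg G ≤ B
  *-maxDeg-lub G c bound = *-foldr-⊔-lub (deg G) c bound (allFin n)

  maxDeg-lub : ∀ (G : Multigraph n) {B} → (∀ v → deg G v ≤ B) → maxDeg G ≤ B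
  maxDeg-lub G {B} bound =
    subst (_≤ B) (*-identityˡ (maxDeg G))
      (*-maxDeg-lub G 1 (λ v → subst (_≤ B) (sym (*-identityˡ (deg G v))) (bound v)))

  maxDeg-mono : ∀ {H G : Multigraph n} → H ⊑ G → maxDeg H ≤ maxDeg G
  maxDeg-mono {H} {G} H⊑G =
    maxDeg-lub H (λ v → ≤-trans (sum-map-mono-⊆ (incid v) H⊑G) (deg≤maxDeg G v))

  numEdges≤degreeSum : ∀ (G : Multigraph n) → numEdges G ≤ sum (map (deg G) (allFin n))
  numEdges≤degreeSum (mkGraph []) = z≤n
  numEdges≤degreeSum (mkGraph (e@(a , b) ∷ E)) = begin
    1 + length E
      ≤⟨ +-mono-≤ e-has-an-endpoint (numEdges≤degreeSum (mkGraph E)) ⟩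
    sum (map (λ v → incid v e) (allFin n)) + sum (map (deg (mkGraph E)) (allFin n))
      ≡⟨ sum-map-+ (λ v → incid v e) (deg (mkGraph E)) (allFin n) ⟨
    sum (map (deg (mkGraph (e ∷ E))) (allFin n)) ∎
    where
    open ≤-Reasoning
    e-has-an-endpoint : 1 ≤ sum (map (λ v → incid v e) (allFin n))
    e-has-an-endpoint = begin
      1                                      ≡⟨ δ-refl a ⟨
      δ a a                                  ≤⟨ m≤m+n (δ a a) (δ a b) ⟩
      incid a e                              ≤⟨ ∈⇒≤sum-map (λ v → incid v e) (∈-allFin a) ⟩
      sum (map (λ v → incid v e) (allFin n)) ∎

  numEdges≤n*maxDeg : ∀ (G : Multigraph n) → numEdges G ≤ n * maxDeg G
  numEdges≤n*maxDeg G = begin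
    numEdges G                           ≤⟨ numEdges≤degreeSum G ⟩
    sum (map (deg G) (allFin n))         ≤⟨ sum-map-≤ (deg G) (deg≤maxDeg G) (allFin n) ⟩
    length (allFin n) * maxDeg G         ≡⟨ cong (_* maxDeg G) (length-tabulate {n = n} id) ⟩
    n * maxDeg G                         ∎
    where open ≤-Reasoning

  open EquitableSplit (_≟ᶠ_ {n}) using (major-part; double-degree-≤)

  Thinning : Multigraph n → ℕ → Set
  Thinning G k = Σ (Multigraph n) λ H → H ⊑ G × numEdges H ≡ k ×
                 (maxDeg H ∸ 2) * numEdges G ≤ 2 * k * (maxDeg G ∸ 2)

  prefix-thinning : ∀ G k → k ≤ numEdges G → numEdges G ≤ 2 * k ⊎ maxDeg G ≤ 2 → Thinning G k
  prefix-thinning G@(mkGraph E) k k≤m small =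
    H , take-⊆ k E , trans (length-take k E) (m≤n⇒m⊓n≡m k≤m) , bound small
    where
    H = mkGraph (take k E)
    bound : numEdges G ≤ 2 * k ⊎ maxDeg G ≤ 2 → (maxDeg H ∸ 2) * numEdges G ≤ 2 * k * (maxDeg G ∸ 2)
    bound (inj₁ m≤2k) = begin
      (maxDeg H ∸ 2) * numEdges G ≤⟨ *-mono-≤ (∸-monoˡ-≤ 2 (maxDeg-mono (take-⊆ k E))) m≤2k ⟩
      (maxDeg G ∸ 2) * (2 * k)    ≡⟨ *-comm (maxDeg G ∸ 2) (2 * k) ⟩
      2 * k * (maxDeg G ∸ 2)      ∎
      where open ≤-Reasoning
    bound (inj₂ Δ≤2) rewrite m≤n⇒m∸n≡0 (≤-trans (maxDeg-mono {H} {G} (take-⊆ k E)) Δ≤2) = z≤n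

  thinning-lift : ∀ {G C : Multigraph n} {k} → C ⊑ G → numEdges G ≤ 2 * numEdges C →
                  2 * maxDeg C ≤ 2 + maxDeg G → Thinning C k → Thinning G k
  thinning-lift {G} {C} {k} C⊑G m≤2c 2ΔC≤2+ΔG (H , H⊑C , refl , bound) =
    H , ⊆-trans H⊑C C⊑G , refl , (begin
      (maxDeg H ∸ 2) * numEdges G         ≤⟨ *-monoʳ-≤ (maxDeg H ∸ 2) m≤2c ⟩
      (maxDeg H ∸ 2) * (2 * numEdges C)   ≡⟨ m*[n*o]≡n*[m*o] (maxDeg H ∸ 2) 2 (numEdges C) ⟩
      2 * ((maxDeg H ∸ 2) * numEdges C)   ≤⟨ *-monoʳ-≤ 2 bound ⟩
      2 * (2 * k * (maxDeg C ∸ 2))        ≡⟨ m*[n*o]≡n*[m*o] 2 (2 * k) (maxDeg C ∸ 2) ⟩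
      2 * k * (2 * (maxDeg C ∸ 2))        ≤⟨ *-monoʳ-≤ (2 * k) excess-halves ⟩
      2 * k * (maxDeg G ∸ 2)              ∎)
    where
    open ≤-Reasoning
    excess-halves : 2 * (maxDeg C ∸ 2) ≤ maxDeg G ∸ 2
    excess-halves = ≤-trans (≤-reflexive (*-distribˡ-∸ 2 (maxDeg C) 2)) (∸-monoˡ-≤ 4 2ΔC≤2+ΔG)

  thinning : ∀ (G : Multigraph n) k → k ≤ numEdges G → Thinning G k
  thinning G k = go G (<-wellFounded (numEdges G))
    where
    go : ∀ G → Acc _<_ (numEdges G) → k ≤ numEdges G → Thinning G k
    go G@(mkGraph E) (acc rec) k≤m with numEdges G ≤? 2 * k | major-part E
    ... | yes m≤2k | _ = prefix-thinning G k k≤m (inj₁ m≤2k)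
    ... | no _ | C , [] , C⋈[] , _ , C≤2 =
      prefix-thinning G k k≤m (inj₂ (maxDeg-lub G λ v →
        ≤-trans (≤-reflexive (trans (degree-interleaving C⋈[] v) (+-identityʳ _))) (C≤2 v)))
    ... | no m≰2k | C , e ∷ C′ , C⋈C′ , c′≤c , C≤2+C′ with interleaving-major C⋈C′ c′≤c
    ...   | c<m , m≤2c =
      thinning-lift (interleaving⇒⊆ˡ C⋈C′) m≤2c
        (*-maxDeg-lub (mkGraph C) 2 λ v →
          ≤-trans (double-degree-≤ C⋈C′ {v} (C≤2+C′ v)) (+-monoʳ-≤ 2 (deg≤maxDeg G v)))
        (go (mkGraph C) (rec c<m) (<⇒≤ (*-cancelˡ-< 2 k (length C) (<-≤-trans (≰⇒> m≰2k) m≤2c))))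

excess-bound⇒degree-bound : ∀ Δ′ Δ m k n → (Δ′ ∸ 2) * m ≤ 2 * k * (Δ ∸ 2) → m ≤ n * Δ →
                     Δ′ * m ≤ (2 * k + 4 * n) * Δ
excess-bound⇒degree-bound Δ′ Δ m k n excess m≤nΔ = begin
  Δ′ * m                          ≤⟨ *-monoˡ-≤ m (m≤n+m∸n Δ′ 2) ⟩
  (2 + (Δ′ ∸ 2)) * m              ≡⟨ *-distribʳ-+ m 2 (Δ′ ∸ 2) ⟩
  2 * m + (Δ′ ∸ 2) * m            ≤⟨ +-mono-≤ (*-monoʳ-≤ 2 m≤nΔ)
                                              (≤-trans excess (*-monoʳ-≤ (2 * k) (m∸n≤m Δ 2))) ⟩
  2 * (n * Δ) + 2 * k * Δ         ≡⟨ +-comm (2 * (n * Δ)) (2 * k * Δ) ⟩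
  2 * k * Δ + 2 * (n * Δ)         ≤⟨ +-monoʳ-≤ (2 * k * Δ) (*-monoˡ-≤ (n * Δ) (m≤m+n 2 2)) ⟩
  2 * k * Δ + 4 * (n * Δ)         ≡⟨ cong (2 * k * Δ +_) (*-assoc 4 n Δ) ⟨
  2 * k * Δ + 4 * n * Δ           ≡⟨ *-distribʳ-+ Δ (2 * k) (4 * n) ⟨
  (2 * k + 4 * n) * Δ             ∎
  where open ≤-Reasoning

lemma5p1 : (n : ℕ) (G : Multigraph n) (k : ℕ) → k ≤ numEdges G →
    Σ (Multigraph n) (λ G' → (G' ⊑ G) × (numEdges G' ≡ k) ×
      (maxDeg G' * numEdges G ≤ (2 * k + 4 * n) * maxDeg G))
lemma5p1 n G k k≤m with thinning G k k≤m
... | H , H⊑G , |H|≡k , excess =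
  H , H⊑G , |H|≡k ,
  excess-bound⇒degree-bound (maxDeg H) (maxDeg G) (numEdges G) k n excess (numEdges≤n*maxDeg G)
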